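{- For every matroid $M$, $\kappa(M)=\kappa(M^*)$, where $M^*$ is the dual matroid.
   Context: A non-basis of a matroid $M$ is a set of size $r(M)$ that is not a basis. A flat $F$ of $M$ covers a set $X$ if $|X\cap F|>r_M(F)$. A flat cover of $M$ is a set of flats of $M$ such that every non-basis of $M$ is covered by some member. The cover complexity $\kappa(M)$ is the minimum size of a flat cover of $M$. -}

module Defs where

open import Level using (0ℓ)
open import Data.Nat using (ℕ; _<_; _≤_)
open import Data.Fin using (Fin)
open import Data.Fin.Subset using (Subset; _∈_; _∉_; _∩_; _∪_; _-_; ∁; ⁅_⁆; ∣_∣; ⊤)
open import Data.List using (List; length)
open import Data.List.Relation.Unary.All using (All)
open import Data.List.Relation.Unary.Any using (Any)
open import Data.List.Relation.Unary.Unique.Propositional using (Unique)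
open import Data.Product using (Σ; ∃; _×_)
open import Relation.Nullary using (¬_)
open import Relation.Unary using (Decidable)
open import Relation.Binary.PropositionalEquality using (_≡_)

-- Decidability of being a basis is automatic classically (finite ground set);
-- it is included only because Agda is constructive.
record Matroid (n : ℕ) : Set₁ where
  field
    IsBasis      : Subset n → Set
    basis?       : Decidable IsBasis
    basis-exists : ∃ IsBasis
    exchange     : ∀ {B₁ B₂ x} → IsBasis B₁ → IsBasis B₂ → x ∈ B₁ → x ∉ B₂ →
                   ∃ λ y → y ∈ B₂ × y ∉ B₁ × IsBasis ((B₁ - x) ∪ ⁅ y ⁆)
open Matroid public

module _ {n : ℕ} (𝔅 : Subset n → Set) where

  RankIs : Subset n → ℕ → Set
  RankIs X k = (∃ λ B → 𝔅 B × ∣ X ∩ B ∣ ≡ k) × (∀ B → 𝔅 B → ∣ X ∩ B ∣ ≤ k)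

  NonBasis : Subset n → Set
  NonBasis X = (∃ λ r → RankIs ⊤ r × ∣ X ∣ ≡ r) × ¬ 𝔅 X

  IsFlat : Subset n → Set
  IsFlat F = ∀ e → e ∉ F → ∀ r r′ → RankIs F r → RankIs (F ∪ ⁅ e ⁆) r′ → r < r′

  Covers : Subset n → Subset n → Set
  Covers F X = ∃ λ r → RankIs F r × r < ∣ X ∩ F ∣

  -- a flat cover, given as a duplicate-free list of flats (a finite set of flats)
  IsFlatCover : List (Subset n) → Set
  IsFlatCover Fs = Unique Fs × All IsFlat Fs ×
                   (∀ X → NonBasis X → Any (λ F → Covers F X) Fs)

  CoverComplexityIs : ℕ → Set
  CoverComplexityIs k = (∃ λ Fs → IsFlatCover Fs × length Fs ≡ k) ×
                        (∀ Fs → IsFlatCover Fs → k ≤ length Fs)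

DualBasis : ∀ {n} → Matroid n → Subset n → Set
DualBasis M X = IsBasis M (∁ X)

module Submission where

-- If F has rank s in M, then E − F has rank |E − F| − r(M) + s in M*. Hence when a non-basis X
-- of M meets F in more than s elements, its complement E − X, a non-basis of M*, meets E − F
-- in more than r*(E − F) elements, and so is covered by the M*-closure of E − F. Replacing each
-- member of a flat cover of M by the M*-closure of its complement gives a flat cover of M* that
-- is no larger; as M** = M, the minimum sizes agree.

open import Data.Bool using (true; false; not)
import Data.Bool as Bool
open import Data.Bool.Properties using (not-involutive)
open import Data.Fin using (Fin; zero; suc)
import Data.Fin
open import Data.Fin.Subset
open import Data.Fin.Subset.Properties
open import Data.List using (List; map; length; deduplicate)
open import Data.List.Properties using (length-deduplicate; length-map)
import Data.List.Relation.Unary.All as All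
import Data.List.Relation.Unary.All.Properties as All
import Data.List.Relation.Unary.Any as Any
import Data.List.Relation.Unary.Any.Properties as Any
import Data.List.Relation.Unary.Unique.DecPropositional.Properties as Unique
open import Data.Nat using (ℕ; zero; suc; _+_; _∸_; _≤_; _<_; _≤?_; s≤s)
open import Data.Nat.Induction using (<-wellFounded)
open import Data.Nat.Properties
open import Data.Product using (∃; _×_; _,_; proj₁; proj₂)
open import Data.Sum using (_⊎_; inj₁; inj₂)
open import Data.Vec using ([]; _∷_; here; there)
open import Data.Vec.Properties using (map-∘; map-cong; map-id; ≡-dec)
open import Function using (_∘_; id)
open import Function.Bundles using (_⇔_; mk⇔; Equivalence)
open import Induction.WellFounded using (Acc; acc)
open import Relation.Binary.Definitions using (DecidableEquality)
open import Relation.Binary.PropositionalEquality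
open import Relation.Nullary using (yes; no; ¬_; contradiction)
open import Relation.Nullary.Decidable using (_×-dec_; map′)
open import Relation.Unary using (Decidable)

open import Defs

_≟ₛ_ : ∀ {n} → DecidableEquality (Subset n)
_≟ₛ_ = ≡-dec Bool._≟_

∁-involutive : ∀ {n} (p : Subset n) → ∁ (∁ p) ≡ p
∁-involutive p = trans (sym (map-∘ not not p)) (trans (map-cong not-involutive p) (map-id p))

∣p∣+∣∁p∣≡n : ∀ {n} (p : Subset n) → ∣ p ∣ + ∣ ∁ p ∣ ≡ n
∣p∣+∣∁p∣≡n p = trans (cong (∣ p ∣ +_) (∣∁p∣≡n∸∣p∣ p)) (m+[n∸m]≡n (∣p∣≤n p))

-- Inclusion–exclusion for p and ∁ q, written without subtraction.
∣∁p∩q∣+[∣p∣+∣∁q∣]≡n+∣p∩∁q∣ : ∀ {n} (p q : Subset n) →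
  ∣ ∁ p ∩ q ∣ + (∣ p ∣ + ∣ ∁ q ∣) ≡ n + ∣ p ∩ ∁ q ∣
∣∁p∩q∣+[∣p∣+∣∁q∣]≡n+∣p∩∁q∣ [] [] = refl
∣∁p∩q∣+[∣p∣+∣∁q∣]≡n+∣p∩∁q∣ {suc n} (s ∷ p) (t ∷ q) = step s t
  where
  c a b d : ℕ
  c = ∣ ∁ p ∩ q ∣
  a = ∣ p ∣
  b = ∣ ∁ q ∣
  d = ∣ p ∩ ∁ q ∣
  ih : c + (a + b) ≡ n + d
  ih = ∣∁p∩q∣+[∣p∣+∣∁q∣]≡n+∣p∩∁q∣ p q
  step : ∀ s t → ∣ ∁ (s ∷ p) ∩ (t ∷ q) ∣ + (∣ s ∷ p ∣ + ∣ ∁ (t ∷ q) ∣) ≡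
                 suc n + ∣ (s ∷ p) ∩ ∁ (t ∷ q) ∣
  step true true = trans (+-suc c (a + b)) (cong suc ih)
  step true false rewrite +-suc c (a + suc b) | +-suc a b | +-suc c (a + b) | +-suc n d =
    cong (λ k → suc (suc k)) ih
  step false true = cong suc ih
  step false false rewrite +-suc a b | +-suc c (a + b) = cong suc ih

x∈p─q⇒x∉q : ∀ {n} {x : Fin n} (p q : Subset n) → x ∈ p ─ q → x ∉ q
x∈p─q⇒x∉q (true ∷ p) (false ∷ q) here = λ ()
x∈p─q⇒x∉q (s ∷ p) (t ∷ q) (there x∈p─q) (there x∈q) = x∈p─q⇒x∉q p q x∈p─q x∈q

∣p∪q∣≤∣p∣+∣q∣ : ∀ {n} (p q : Subset n) → ∣ p ∪ q ∣ ≤ ∣ p ∣ + ∣ q ∣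
∣p∪q∣≤∣p∣+∣q∣ [] [] = ≤-refl
∣p∪q∣≤∣p∣+∣q∣ (true ∷ p) (t ∷ q) = s≤s (≤-trans (∣p∪q∣≤∣p∣+∣q∣ p q) (+-monoʳ-≤ ∣ p ∣ (∣p∣≤∣x∷p∣ t q)))
∣p∪q∣≤∣p∣+∣q∣ (false ∷ p) (true ∷ q) =
  ≤-trans (s≤s (∣p∪q∣≤∣p∣+∣q∣ p q)) (≤-reflexive (sym (+-suc ∣ p ∣ ∣ q ∣)))
∣p∪q∣≤∣p∣+∣q∣ (false ∷ p) (false ∷ q) = ∣p∪q∣≤∣p∣+∣q∣ p q

∣p∣≤1+∣p-x∣ : ∀ {n} (p : Subset n) x → ∣ p ∣ ≤ suc ∣ p - x ∣
∣p∣≤1+∣p-x∣ p x = begin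
  ∣ p ∣                     ≤⟨ p⊆q⇒∣p∣≤∣q∣ p⊆[p-x]∪⁅x⁆ ⟩
  ∣ (p - x) ∪ ⁅ x ⁆ ∣       ≤⟨ ∣p∪q∣≤∣p∣+∣q∣ (p - x) ⁅ x ⁆ ⟩
  ∣ p - x ∣ + ∣ ⁅ x ⁆ ∣     ≡⟨ cong (∣ p - x ∣ +_) (∣⁅x⁆∣≡1 x) ⟩
  ∣ p - x ∣ + 1             ≡⟨ +-comm ∣ p - x ∣ 1 ⟩
  suc ∣ p - x ∣             ∎
  where
  open ≤-Reasoning
  p⊆[p-x]∪⁅x⁆ : p ⊆ (p - x) ∪ ⁅ x ⁆
  p⊆[p-x]∪⁅x⁆ {z} z∈p with z Data.Fin.≟ x
  ... | yes refl = x∈p∪q⁺ (inj₂ (x∈⁅x⁆ x))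
  ... | no z≢x   = x∈p∪q⁺ (inj₁ (x∈p∧x≢y⇒x∈p-y z∈p z≢x))

∣p∣≤∣[p-x]∪⁅y⁆∣ : ∀ {n} {p : Subset n} {x y} → y ∉ p → ∣ p ∣ ≤ ∣ (p - x) ∪ ⁅ y ⁆ ∣
∣p∣≤∣[p-x]∪⁅y⁆∣ {p = p} {x} {y} y∉p = ≤-trans (∣p∣≤1+∣p-x∣ p x)
  (p⊂q⇒∣p∣<∣q∣ (p⊆p∪q ⁅ y ⁆ , y , x∈p∪q⁺ (inj₂ (x∈⁅x⁆ y)) , y∉p ∘ p─q⊆p p ⁅ x ⁆))

∣[p-x]∪⁅y⁆─q∣<∣p─q∣ : ∀ {n} {p q : Subset n} {x y} → x ∈ p ─ q → y ∈ q →
                      ∣ (p - x) ∪ ⁅ y ⁆ ─ q ∣ < ∣ p ─ q ∣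
∣[p-x]∪⁅y⁆─q∣<∣p─q∣ {p = p} {q} {x} {y} x∈p─q y∈q =
  ≤-<-trans (p⊆q⇒∣p∣≤∣q∣ ⊆[p─q]-x) (x∈p⇒∣p-x∣<∣p∣ x∈p─q)
  where
  ⊆[p─q]-x : (p - x) ∪ ⁅ y ⁆ ─ q ⊆ (p ─ q) - x
  ⊆[p─q]-x {z} z∈ with x∈p∪q⁻ (p - x) ⁅ y ⁆ (p─q⊆p _ q z∈)
  ... | inj₁ z∈p-x = x∈p∧x≢y⇒x∈p-y (x∈p∧x∉q⇒x∈p─q (p─q⊆p p ⁅ x ⁆ z∈p-x) (x∈p─q⇒x∉q _ q z∈))
                                    (x∉⁅y⁆⇒x≢y (x∈p─q⇒x∉q p ⁅ x ⁆ z∈p-x))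
  ... | inj₂ z∈⁅y⁆ = contradiction (subst (_∈ q) (sym (x∈⁅y⁆⇒x≡y y z∈⁅y⁆)) y∈q) (x∈p─q⇒x∉q _ q z∈)

cancel-offset-≤ : ∀ {a b c m s u} → a + c ≡ m + s → b + c ≡ m + u → s ≤ u → a ≤ b
cancel-offset-≤ {a} {b} {c} {m} {s} {u} a+c≡m+s b+c≡m+u s≤u = +-cancelʳ-≤ c a b (begin
  a + c ≡⟨ a+c≡m+s ⟩
  m + s ≤⟨ +-monoʳ-≤ m s≤u ⟩
  m + u ≡⟨ b+c≡m+u ⟨
  b + c ∎)
  where open ≤-Reasoning

cancel-offset-< : ∀ {a b c m s u} → a + c ≡ m + s → b + c ≡ m + u → s < u → a < b
cancel-offset-< {m = m} {s} a+c≡m+s = cancel-offset-≤ (trans (cong suc a+c≡m+s) (sym (+-suc m s)))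

∩-monoˡ-⊆ : ∀ {n} {p q : Subset n} (r : Subset n) → p ⊆ q → p ∩ r ⊆ q ∩ r
∩-monoˡ-⊆ {p = p} r p⊆q x∈p∩r = let x∈p , x∈r = x∈p∩q⁻ p r x∈p∩r in x∈p∩q⁺ (p⊆q x∈p , x∈r)

∩-monoʳ-⊆ : ∀ {n} {p q : Subset n} (r : Subset n) → p ⊆ q → r ∩ p ⊆ r ∩ q
∩-monoʳ-⊆ {p = p} r p⊆q x∈r∩p = let x∈r , x∈p = x∈p∩q⁻ r p x∈r∩p in x∈p∩q⁺ (x∈r , p⊆q x∈p)

record Maximum {n} (P : Subset n → Set) (f : Subset n → ℕ) : Set where
  constructor mkMaximum
  field
    argmax  : Subset n
    holds   : P argmax
    maximal : ∀ y → P y → f y ≤ f argmax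

maximum⊎empty : ∀ {n} {P : Subset n → Set} → Decidable P → (f : Subset n → ℕ) →
                Maximum P f ⊎ (∀ x → ¬ P x)
maximum⊎empty {zero} P? f with P? []
... | yes P[] = inj₁ (mkMaximum [] P[] λ { [] _ → ≤-refl })
... | no ¬P[] = inj₂ λ { [] → ¬P[] }
maximum⊎empty {suc n} P? f
  with maximum⊎empty (P? ∘ (true ∷_)) (f ∘ (true ∷_)) | maximum⊎empty (P? ∘ (false ∷_)) (f ∘ (false ∷_))
... | inj₂ none₁ | inj₂ none₀ = inj₂ λ { (true ∷ x) → none₁ x ; (false ∷ x) → none₀ x }
... | inj₁ (mkMaximum x px max₁) | inj₂ none₀ =
  inj₁ (mkMaximum (true ∷ x) px
    λ { (true ∷ y) py → max₁ y py ; (false ∷ y) py → contradiction py (none₀ y) })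
... | inj₂ none₁ | inj₁ (mkMaximum x px max₀) =
  inj₁ (mkMaximum (false ∷ x) px
    λ { (false ∷ y) py → max₀ y py ; (true ∷ y) py → contradiction py (none₁ y) })
... | inj₁ (mkMaximum x₁ px₁ max₁) | inj₁ (mkMaximum x₀ px₀ max₀)
  with ≤-total (f (true ∷ x₁)) (f (false ∷ x₀))
...   | inj₁ f₁≤f₀ = inj₁ (mkMaximum (false ∷ x₀) px₀
          λ { (false ∷ y) py → max₀ y py ; (true ∷ y) py → ≤-trans (max₁ y py) f₁≤f₀ })
...   | inj₂ f₀≤f₁ = inj₁ (mkMaximum (true ∷ x₁) px₁
          λ { (true ∷ y) py → max₁ y py ; (false ∷ y) py → ≤-trans (max₀ y py) f₀≤f₁ })

maximum : ∀ {n} {P : Subset n → Set} → Decidable P → (f : Subset n → ℕ) → ∃ P → Maximum P f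
maximum P? f (x , px) with maximum⊎empty P? f
... | inj₁ max  = max
... | inj₂ none = contradiction px (none x)

module _ {n : ℕ} {𝔅 : Subset n → Set} where

  rankIs-unique : ∀ {X s t} → RankIs 𝔅 X s → RankIs 𝔅 X t → s ≡ t
  rankIs-unique ((B , b , ∣X∩B∣≡s) , max-s) ((B′ , b′ , ∣X∩B′∣≡t) , max-t) =
    ≤-antisym (subst (_≤ _) ∣X∩B∣≡s (max-t B b)) (subst (_≤ _) ∣X∩B′∣≡t (max-s B′ b′))

  rankIs-mono : ∀ {X Y s t} → X ⊆ Y → RankIs 𝔅 X s → RankIs 𝔅 Y t → s ≤ t
  rankIs-mono X⊆Y ((B , b , ∣X∩B∣≡s) , _) (_ , max-t) =
    subst (_≤ _) ∣X∩B∣≡s (≤-trans (p⊆q⇒∣p∣≤∣q∣ (∩-monoˡ-⊆ B X⊆Y)) (max-t B b))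

  rankIs-⊤ : ∀ {r} → ∃ 𝔅 → (∀ {B} → 𝔅 B → ∣ B ∣ ≡ r) → RankIs 𝔅 ⊤ r
  rankIs-⊤ (B , b) size =
    (B , b , trans (cong ∣_∣ (∩-identityˡ B)) (size b)) ,
    λ B′ b′ → ≤-reflexive (trans (cong ∣_∣ (∩-identityˡ B′)) (size b′))

  module Rank (𝔅? : Decidable 𝔅) (𝔅-nonempty : ∃ 𝔅) where

    rank : Subset n → ℕ
    rank X = ∣ X ∩ Maximum.argmax (maximum 𝔅? (λ B → ∣ X ∩ B ∣) 𝔅-nonempty) ∣

    rankIs-rank : ∀ X → RankIs 𝔅 X (rank X)
    rankIs-rank X = let mkMaximum B b max = maximum 𝔅? (λ B → ∣ X ∩ B ∣) 𝔅-nonempty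
                    in (B , b , refl) , max

    -- G has maximum size among the supersets of H of rank ≤ t, so adding any element raises the rank.
    closure : ∀ {H t} → RankIs 𝔅 H t → ∃ λ G → H ⊆ G × RankIs 𝔅 G t × IsFlat 𝔅 G
    closure {H} {t} rkH
      with maximum {P = λ S → H ⊆ S × rank S ≤ t} (λ S → (H ⊆? S) ×-dec (rank S ≤? t)) ∣_∣
             (H , ⊆-refl , ≤-reflexive (rankIs-unique {X = H} (rankIs-rank H) rkH))
    ... | mkMaximum G (H⊆G , rankG≤t) largest = G , H⊆G , rkG , flat
      where
      rkG : RankIs 𝔅 G t
      rkG = subst (RankIs 𝔅 G) (≤-antisym rankG≤t (rankIs-mono H⊆G rkH (rankIs-rank G))) (rankIs-rank G)
      flat : IsFlat 𝔅 G
      flat e e∉G s s′ rk-s rk-s′ with s′ ≤? t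
      ... | yes s′≤t = contradiction (largest (G ∪ ⁅ e ⁆) (⊆-trans H⊆G (p⊆p∪q ⁅ e ⁆) , rank≤t))
                                     (<⇒≱ (p⊂q⇒∣p∣<∣q∣ (p⊆p∪q ⁅ e ⁆ , e , x∈p∪q⁺ (inj₂ (x∈⁅x⁆ e)) , e∉G)))
        where
        rank≤t : rank (G ∪ ⁅ e ⁆) ≤ t
        rank≤t = subst (_≤ t) (rankIs-unique {X = G ∪ ⁅ e ⁆} rk-s′ (rankIs-rank (G ∪ ⁅ e ⁆))) s′≤t
      ... | no s′≰t = subst (_< s′) (rankIs-unique {X = G} rkG rk-s) (≰⇒> s′≰t)

module _ {n : ℕ} (M : Matroid n) where

  -- Exchanging an element of B ─ B₂ for one of B₂ keeps B a basis, does not shrink it,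
  -- and makes B ─ B₂ smaller.
  basis-∣∣-≤ : ∀ {B₁ B₂} → IsBasis M B₁ → IsBasis M B₂ → ∣ B₁ ∣ ≤ ∣ B₂ ∣
  basis-∣∣-≤ {B₁} {B₂} b₁ b₂ = go b₁ (<-wellFounded ∣ B₁ ─ B₂ ∣)
    where
    go : ∀ {B} → IsBasis M B → Acc _<_ ∣ B ─ B₂ ∣ → ∣ B ∣ ≤ ∣ B₂ ∣
    go {B} b (acc smaller) with nonempty? (B ─ B₂)
    ... | no empty = p⊆q⇒∣p∣≤∣q∣ B⊆B₂
      where
      B⊆B₂ : B ⊆ B₂
      B⊆B₂ {z} z∈B with z ∈? B₂
      ... | yes z∈B₂ = z∈B₂
      ... | no z∉B₂  = contradiction (z , x∈p∧x∉q⇒x∈p─q z∈B z∉B₂) empty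
    ... | yes (x , x∈B─B₂) with exchange M b b₂ (p─q⊆p B B₂ x∈B─B₂) (x∈p─q⇒x∉q B B₂ x∈B─B₂)
    ...   | y , y∈B₂ , y∉B , b′ =
      ≤-trans (∣p∣≤∣[p-x]∪⁅y⁆∣ y∉B) (go b′ (smaller (∣[p-x]∪⁅y⁆─q∣<∣p─q∣ x∈B─B₂ y∈B₂)))

  basis-∣∣ : ∀ {B₁ B₂} → IsBasis M B₁ → IsBasis M B₂ → ∣ B₁ ∣ ≡ ∣ B₂ ∣
  basis-∣∣ b₁ b₂ = ≤-antisym (basis-∣∣-≤ b₁ b₂) (basis-∣∣-≤ b₂ b₁)

module Duality {n : ℕ} {𝔅 𝔇 : Subset n → Set} {r : ℕ}
  (𝔅? : Decidable 𝔅) (𝔅-nonempty : ∃ 𝔅) (𝔅-size : ∀ {B} → 𝔅 B → ∣ B ∣ ≡ r)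
  (dual : ∀ X → 𝔇 X ⇔ 𝔅 (∁ X)) where

  open Equivalence

  𝔅-dual : ∀ X → 𝔅 X ⇔ 𝔇 (∁ X)
  𝔅-dual X = mk⇔ (from (dual (∁ X)) ∘ subst 𝔅 (sym (∁-involutive X)))
                 (subst 𝔅 (∁-involutive X) ∘ to (dual (∁ X)))

  𝔇? : Decidable 𝔇
  𝔇? X = map′ (from (dual X)) (to (dual X)) (𝔅? (∁ X))

  𝔇-nonempty : ∃ 𝔇
  𝔇-nonempty = let B , b = 𝔅-nonempty in ∁ B , to (𝔅-dual B) b

  𝔇-size : ∀ {D} → 𝔇 D → ∣ D ∣ ≡ n ∸ r
  𝔇-size {D} d = begin
    ∣ D ∣         ≡⟨ cong ∣_∣ (∁-involutive D) ⟨
    ∣ ∁ (∁ D) ∣   ≡⟨ ∣∁p∣≡n∸∣p∣ (∁ D) ⟩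
    n ∸ ∣ ∁ D ∣   ≡⟨ cong (n ∸_) (𝔅-size (to (dual D) d)) ⟩
    n ∸ r         ∎
    where open ≡-Reasoning

  -- The dual rank formula r*(E − X) = |E − X| − r(M) + r(X), without subtraction.
  rankIs-∁ : ∀ {X s} → RankIs 𝔅 X s → ∃ λ t → RankIs 𝔇 (∁ X) t × t + (∣ X ∣ + r) ≡ n + s
  rankIs-∁ {X} {s} ((B , b , ∣X∩B∣≡s) , max-s) =
    ∣ ∁ X ∩ ∁ B ∣ , ((∁ B , to (𝔅-dual B) b , refl) , bound) , balance₁
    where
    balance : ∀ {D} → 𝔇 D → ∣ ∁ X ∩ D ∣ + (∣ X ∣ + r) ≡ n + ∣ X ∩ ∁ D ∣
    balance {D} d = subst (λ k → ∣ ∁ X ∩ D ∣ + (∣ X ∣ + k) ≡ n + ∣ X ∩ ∁ D ∣)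
                          (𝔅-size (to (dual D) d)) (∣∁p∩q∣+[∣p∣+∣∁q∣]≡n+∣p∩∁q∣ X D)
    balance₁ : ∣ ∁ X ∩ ∁ B ∣ + (∣ X ∣ + r) ≡ n + s
    balance₁ = trans (balance (to (𝔅-dual B) b))
                     (cong (n +_) (trans (cong (λ C → ∣ X ∩ C ∣) (∁-involutive B)) ∣X∩B∣≡s))
    bound : ∀ D → 𝔇 D → ∣ ∁ X ∩ D ∣ ≤ ∣ ∁ X ∩ ∁ B ∣
    bound D d = cancel-offset-≤ (balance d) balance₁ (max-s (∁ D) (to (dual D) d))

  nonBasis-∁ : ∀ {Y} → NonBasis 𝔇 Y → ∣ ∁ Y ∣ ≡ r × NonBasis 𝔅 (∁ Y)
  nonBasis-∁ {Y} ((r* , ((D , d , ∣⊤∩D∣≡r*) , _) , ∣Y∣≡r*) , ¬dY) =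
    ∣∁Y∣≡r , (r , rankIs-⊤ 𝔅-nonempty 𝔅-size , ∣∁Y∣≡r) , ¬dY ∘ from (dual Y)
    where
    ∣D∣≡∣Y∣ : ∣ D ∣ ≡ ∣ Y ∣
    ∣D∣≡∣Y∣ = trans (cong ∣_∣ (sym (∩-identityˡ D))) (trans ∣⊤∩D∣≡r* (sym ∣Y∣≡r*))
    ∣∁Y∣≡r : ∣ ∁ Y ∣ ≡ r
    ∣∁Y∣≡r = +-cancelˡ-≡ ∣ Y ∣ _ _ (begin
      ∣ Y ∣ + ∣ ∁ Y ∣ ≡⟨ ∣p∣+∣∁p∣≡n Y ⟩
      n               ≡⟨ ∣p∣+∣∁p∣≡n D ⟨
      ∣ D ∣ + ∣ ∁ D ∣ ≡⟨ cong₂ _+_ ∣D∣≡∣Y∣ (𝔅-size (to (dual D) d)) ⟩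
      ∣ Y ∣ + r       ∎)
      where open ≡-Reasoning

  open Rank {𝔅 = 𝔅} 𝔅? 𝔅-nonempty using (rankIs-rank)
  open Rank {𝔅 = 𝔇} 𝔇? 𝔇-nonempty using (closure)

  -- G is cl*(E − F); F itself need not be a flat.
  dualFlat : ∀ F → ∃ λ G → IsFlat 𝔇 G × (∀ Y → ∣ ∁ Y ∣ ≡ r → Covers 𝔅 F (∁ Y) → Covers 𝔇 G Y)
  dualFlat F with rankIs-∁ {X = F} (rankIs-rank F)
  ... | t , rk∁F , balanceF with closure rk∁F
  ...   | G , ∁F⊆G , rkG , flatG = G , flatG , covers
    where
    covers : ∀ Y → ∣ ∁ Y ∣ ≡ r → Covers 𝔅 F (∁ Y) → Covers 𝔇 G Y
    covers Y ∣∁Y∣≡r (s , rk-s , s<∣∁Y∩F∣) =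
      t , rkG , <-≤-trans t<∣Y∩∁F∣ (p⊆q⇒∣p∣≤∣q∣ (∩-monoʳ-⊆ Y ∁F⊆G))
      where
      balanceY : ∣ Y ∩ ∁ F ∣ + (∣ F ∣ + r) ≡ n + ∣ ∁ Y ∩ F ∣
      balanceY = subst₂ (λ A C → ∣ A ∣ + (∣ F ∣ + r) ≡ n + ∣ C ∣) (∩-comm (∁ F) Y) (∩-comm F (∁ Y))
                   (subst (λ k → ∣ ∁ F ∩ Y ∣ + (∣ F ∣ + k) ≡ n + ∣ F ∩ ∁ Y ∣) ∣∁Y∣≡r
                     (∣∁p∩q∣+[∣p∣+∣∁q∣]≡n+∣p∩∁q∣ F Y))
      t<∣Y∩∁F∣ : t < ∣ Y ∩ ∁ F ∣
      t<∣Y∩∁F∣ = cancel-offset-< balanceF balanceY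
                   (subst (_< ∣ ∁ Y ∩ F ∣) (rankIs-unique {X = F} rk-s (rankIs-rank F)) s<∣∁Y∩F∣)

  flatCover-∁ : ∀ Fs → IsFlatCover 𝔅 Fs → ∃ λ Gs → IsFlatCover 𝔇 Gs × length Gs ≤ length Fs
  flatCover-∁ Fs (_ , _ , covering) =
    deduplicate _≟ₛ_ Gs ,
    (Unique.deduplicate-! _≟ₛ_ Gs ,
     All.deduplicate⁺ _≟ₛ_ (All.map⁺ (All.universal (proj₁ ∘ proj₂ ∘ dualFlat) Fs)) ,
     λ Y nonBasis → let ∣∁Y∣≡r , nonBasis∁ = nonBasis-∁ nonBasis in
       Any.deduplicate⁺ _≟ₛ_ (λ { refl c → c })
         (Any.map⁺ (Any.map (λ {F} → proj₂ (proj₂ (dualFlat F)) Y ∣∁Y∣≡r) (covering (∁ Y) nonBasis∁)))) ,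
    ≤-trans (length-deduplicate _≟ₛ_ Gs) (≤-reflexive (length-map (proj₁ ∘ dualFlat) Fs))
    where
    Gs : List (Subset n)
    Gs = map (proj₁ ∘ dualFlat) Fs

-- CoverComplexityIs 𝔅 k unfolds to IsLeast (IsFlatCover 𝔅) length k.
IsLeast : {A : Set} → (A → Set) → (A → ℕ) → ℕ → Set
IsLeast P size k = (∃ λ x → P x × size x ≡ k) × (∀ x → P x → k ≤ size x)

isLeast-transfer : ∀ {A : Set} {P Q : A → Set} (size : A → ℕ) {k} →
  (∀ x → P x → ∃ λ y → Q y × size y ≤ size x) →
  (∀ y → Q y → ∃ λ x → P x × size x ≤ size y) →
  IsLeast P size k → IsLeast Q size k
isLeast-transfer {P = P} {Q} size {k} P⇒Q Q⇒P ((x , px , size-x≡k) , least-P) =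
  let y , qy , y≤x = P⇒Q x px in
  (y , qy , ≤-antisym (subst (size y ≤_) size-x≡k y≤x) (least-Q y qy)) , least-Q
  where
  least-Q : ∀ y → Q y → k ≤ size y
  least-Q y qy = let x′ , px′ , x′≤y = Q⇒P y qy in ≤-trans (least-P x′ px′) x′≤y

lemma3p3 : ∀ {n : ℕ} (M : Matroid n) (k : ℕ) →
    CoverComplexityIs (IsBasis M) k ⇔ CoverComplexityIs (DualBasis M) k
lemma3p3 M k = mk⇔ (isLeast-transfer length M.flatCover-∁ M*.flatCover-∁)
                   (isLeast-transfer length M*.flatCover-∁ M.flatCover-∁)
  where
  module M  = Duality (basis? M) (basis-exists M) (λ b → basis-∣∣ M b (proj₂ (basis-exists M)))
                      (λ X → mk⇔ id id)
  module M* = Duality M.𝔇? M.𝔇-nonempty M.𝔇-size M.𝔅-dual
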